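{- Let $(G,k)$ be an instance of PITVD and let $S\subseteq V(G)$ be such that $G-S$ is a simple graph each of whose components is a proper interval graph or a tree. Let $V_1$ be the union of the vertex sets of the connected components of $G-S$ that contain a cycle, and let $\mathcal{C}$ be the set of connected components of $G[V_1]$. Let $\mathcal{B}$ be the bipartite graph with bipartition $(S,\mathcal{C})$ in which $s\in S$ is adjacent to $D\in\mathcal{C}$ iff $s$ has a neighbor in $D$ in $G$. Suppose $|\mathcal{C}|\ge 3|S|$ and let $\widehat{S}\subseteq S$ and $\widehat{\mathcal{C}}\subseteq\mathcal{C}$ be non-empty sets such that (i) there is a $3$-expansion of $\widehat{S}$ into $\widehat{\mathcal{C}}$ in $\mathcal{B}$, and (ii) $N_{\mathcal{B}}(\widehat{\mathcal{C}})\subseteq\widehat{S}$. Then $(G,k)$ is a yes-instance of PITVD if and only if $(G-\widehat{S},k-|\widehat{S}|)$ is a yes-instance of PITVD.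
   Context: PITVD: given an undirected (multi)graph $G$ without self-loops and an integer $k$, decide whether there is $X\subseteq V(G)$, $|X|\le k$, such that $G-X$ is a simple graph every connected component of which is a proper interval graph or a tree. For a bipartite graph with bipartition $(A,B)$, $\widehat{A}\subseteq A$, $\widehat{B}\subseteq B$ and a positive integer $q$, a set of edges $M$ is a \emph{$q$-expansion of $\widehat{A}$ into $\widehat{B}$} if every vertex of $\widehat{A}$ is incident to exactly $q$ edges of $M$, and exactly $q|\widehat{A}|$ vertices of $\widehat{B}$ are incident to edges of $M$. -}

module Defs where

open import Data.Nat using (ℕ; zero; suc; _+_; _*_; _≤_; _<_)
open import Data.Integer as ℤ using (ℤ; +_)
open import Data.Fin using (Fin; toℕ)
open import Data.Fin.Subset using (Subset; _∈_; _∉_; _⊆_; _∩_; _─_; ⋃; ∣_∣; Nonempty)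
open import Data.List using (List; map; allFin)
open import Data.Product using (Σ; ∃; ∃-syntax; _×_; _,_)
open import Data.Sum using (_⊎_)
open import Relation.Nullary using (¬_)
open import Relation.Binary.PropositionalEquality using (_≡_; _≢_)
open import Function.Bundles using (_⇔_)
open import Function.Definitions using (Injective)

-- Loopless multigraphs.  A graph lives on (a subset V of) Fin n;
-- mult u v is the number of parallel edges between u and v.
-- Only the multiplicities between vertices of V are meaningful.

record MGraph (n : ℕ) : Set where
  field
    V        : Subset n
    mult     : Fin n → Fin n → ℕ
    sym      : ∀ u v → mult u v ≡ mult v u
    loopless : ∀ v → mult v v ≡ 0
open MGraph public

Adj : ∀ {n} → MGraph n → Fin n → Fin n → Set
Adj G u v = u ∈ V G × v ∈ V G × 1 ≤ mult G u v

_⊖_ : ∀ {n} → MGraph n → Subset n → MGraph n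
G ⊖ X = record { V = V G ─ X ; mult = mult G ; sym = sym G ; loopless = loopless G }

_[_] : ∀ {n} → MGraph n → Subset n → MGraph n
G [ C ] = record { V = C ∩ V G ; mult = mult G ; sym = sym G ; loopless = loopless G }

Simple : ∀ {n} → MGraph n → Set
Simple G = ∀ u v → u ∈ V G → v ∈ V G → mult G u v ≤ 1

data Reach {n} (G : MGraph n) : Fin n → Fin n → Set where
  here  : ∀ {u} → u ∈ V G → Reach G u u
  there : ∀ {u w v} → Adj G u w → Reach G w v → Reach G u v

Connected : ∀ {n} → MGraph n → Set
Connected G = Nonempty (V G) × (∀ u v → u ∈ V G → v ∈ V G → Reach G u v)

IsComponent : ∀ {n} → MGraph n → Subset n → Set
IsComponent G C = Σ _ λ u → u ∈ V G × (∀ v → (v ∈ C) ⇔ Reach G u v)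

HasCycle : ∀ {n} → MGraph n → Set
HasCycle {n} G =
  Σ ℕ λ l → Σ (3 ≤ l) λ _ → Σ (Fin l → Fin n) λ c →
    Injective _≡_ _≡_ c ×
    (∀ i → c i ∈ V G) ×
    (∀ i j → (suc (toℕ i) ≡ toℕ j ⊎ (suc (toℕ i) ≡ l × toℕ j ≡ 0)) →
       Adj G (c i) (c j))

Tree : ∀ {n} → MGraph n → Set
Tree G = Connected G × ¬ HasCycle G

-- proper interval graph: intersection graph of closed intervals
-- [lo v , hi v] none of which properly contains another
-- (endpoints in ℕ: only the order of the finitely many endpoints matters)
ProperInterval : ∀ {n} → MGraph n → Set
ProperInterval {n} G =
  Σ (Fin n → ℕ) λ lo → Σ (Fin n → ℕ) λ hi →
    (∀ v → v ∈ V G → lo v ≤ hi v) ×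
    (∀ u v → u ∈ V G → v ∈ V G → u ≢ v →
       Adj G u v ⇔ (lo u ≤ hi v × lo v ≤ hi u)) ×
    (∀ u v → u ∈ V G → v ∈ V G →
       ¬ (lo u ≤ lo v × hi v ≤ hi u × (lo u < lo v ⊎ hi v < hi u)))

Good : ∀ {n} → MGraph n → Set
Good G = Simple G ×
  (∀ C → IsComponent G C → ProperInterval (G [ C ]) ⊎ Tree (G [ C ]))

PITVD : ∀ {n} → MGraph n → ℤ → Set
PITVD G k = Σ _ λ X → X ⊆ V G × (+ ∣ X ∣) ℤ.≤ k × Good (G ⊖ X)

-- M is an edge set: M x is the set of
-- B-side partners of x.

incidentB : ∀ {a b} → (Fin a → Subset b) → Subset b
incidentB {a} M = ⋃ (map M (allFin a))

IsExpansion : ∀ {a b} → (Fin a → Fin b → Set) → ℕ →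
              Subset a → Subset b → (Fin a → Subset b) → Set
IsExpansion Badj q Â B̂ M =
  (∀ x y → y ∈ M x → x ∈ Â × y ∈ B̂ × Badj x y) ×
  (∀ x → x ∈ Â → ∣ M x ∣ ≡ q) ×
  ∣ incidentB M ∣ ≡ q * ∣ Â ∣

-- Let X solve (G, k). Through the 3-expansion, each s ∈ Ŝ is attached to three components of
-- G[V₁], each containing a cycle and no two adjacent. If X missed all three, the component of s in
-- G − X would contain a cycle and a claw centred at s (an interval meeting three pairwise disjoint
-- intervals properly contains the middle one), so it would be neither a tree nor a proper interval
-- graph. Hence X meets one of the three components of every s ∈ Ŝ ∖ X, and as the expansion sets
-- are disjoint this gives an injection of Ŝ ∪ Y into X, where Y is X minus Ŝ and minus the vertices
-- of the components in Ĉ. Y solves G − Ŝ: by (ii) no edge leaves those components in G − Ŝ, so each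
-- component of (G − Ŝ) − Y lies either inside a component of G − S or inside G − X, and being a tree
-- or a proper interval graph passes to connected induced subgraphs. Conversely, Ŝ together with a
-- solution of G − Ŝ solves G.

module Submission where

open import Data.Bool.Properties using (T-≡)
open import Data.Empty using (⊥-elim)
open import Data.Fin using (Fin; zero; suc)
open import Data.Fin.Properties using (any?)
open import Data.Fin.Subset hiding (_-_)
open import Data.Fin.Subset.Induction using (⊂-wellFounded; Acc; acc)
open import Data.Fin.Subset.Properties
import Data.Integer as ℤ
import Data.Integer.Properties as ℤ
open import Data.Integer.Tactic.RingSolver using (solve-∀)
open import Data.List.Properties using (map-tabulate)
open import Data.Nat using (ℕ; zero; suc; _+_; _*_; _≤_; _<_; z≤n; s≤s; s≤s⁻¹; _≤?_)
open import Data.Nat.GeneralisedArithmetic using (fold)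
open import Data.Nat.Properties
open import Algebra.Properties.Monoid.Sum +-0-monoid using (sum)
open import Data.Product using (Σ; ∃-syntax; _×_; _,_; proj₁; proj₂)
open import Data.Sum using (_⊎_; inj₁; inj₂; [_,_]′)
open import Data.Vec using ([]; _∷_; here; there; tabulate)
open import Data.Vec.Properties using (lookup∘tabulate; []=⇒lookup; lookup⇒[]=)
open import Function using (_∘_; id)
open import Function.Bundles using (_⇔_; mk⇔; Equivalence)
open import Function.Definitions using (Injective)
open import Relation.Binary.PropositionalEquality
  using (_≡_; _≢_; refl; sym; trans; cong; cong₂; subst; module ≡-Reasoning)
open import Relation.Nullary using (¬_; Dec; yes; no; isYes)
open import Relation.Nullary.Decidable using (toWitness; fromWitness; _×-dec_; _⊎-dec_)
open import Relation.Unary using (Decidable)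

open import Defs hiding (sym)

private variable
  a b n : ℕ
  u v w x y : Fin n

-- Finite sets

select : {P : Fin n → Set} → Decidable P → Subset n
select P? = tabulate (isYes ∘ P?)

∈-select : {P : Fin n → Set} (P? : Decidable P) {x : Fin n} → x ∈ select P? ⇔ P x
∈-select P? {x} = mk⇔
  (λ x∈ → toWitness {a? = P? x} (Equivalence.from T-≡ (trans (sym (lookup∘tabulate _ x)) ([]=⇒lookup x∈))))
  (λ Px → lookup⇒[]= x _ (trans (lookup∘tabulate _ x) (Equivalence.to T-≡ (fromWitness Px))))

x∈p─q⇒x∉q : ∀ (p q : Subset n) {x} → x ∈ p ─ q → x ∉ q
x∈p─q⇒x∉q (_ ∷ p) (_ ∷ q) () here
x∈p─q⇒x∉q (_ ∷ p) (_ ∷ q) (there x∈) (there x∈q) = x∈p─q⇒x∉q p q x∈ x∈q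

x∈p-y⁻ : ∀ (p : Subset n) {x y} → x ∈ p ─ ⁅ y ⁆ → x ∈ p × x ≢ y
x∈p-y⁻ p {y = y} x∈ = p─q⊆p p ⁅ y ⁆ x∈ , x∉⁅y⁆⇒x≢y (x∈p─q⇒x∉q p ⁅ y ⁆ x∈)

∣p∪q∣+∣p∩q∣≡∣p∣+∣q∣ : ∀ (p q : Subset n) → ∣ p ∪ q ∣ + ∣ p ∩ q ∣ ≡ ∣ p ∣ + ∣ q ∣
∣p∪q∣+∣p∩q∣≡∣p∣+∣q∣ []            []            = refl
∣p∪q∣+∣p∩q∣≡∣p∣+∣q∣ (inside ∷ p)  (inside ∷ q)  = cong suc (begin
  ∣ p ∪ q ∣ + suc ∣ p ∩ q ∣ ≡⟨ +-suc ∣ p ∪ q ∣ ∣ p ∩ q ∣ ⟩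
  suc (∣ p ∪ q ∣ + ∣ p ∩ q ∣) ≡⟨ cong suc (∣p∪q∣+∣p∩q∣≡∣p∣+∣q∣ p q) ⟩
  suc (∣ p ∣ + ∣ q ∣)         ≡⟨ +-suc ∣ p ∣ ∣ q ∣ ⟨
  ∣ p ∣ + suc ∣ q ∣           ∎)
  where open ≡-Reasoning
∣p∪q∣+∣p∩q∣≡∣p∣+∣q∣ (inside ∷ p)  (outside ∷ q) = cong suc (∣p∪q∣+∣p∩q∣≡∣p∣+∣q∣ p q)
∣p∪q∣+∣p∩q∣≡∣p∣+∣q∣ (outside ∷ p) (inside ∷ q)  =
  trans (cong suc (∣p∪q∣+∣p∩q∣≡∣p∣+∣q∣ p q)) (sym (+-suc ∣ p ∣ ∣ q ∣))
∣p∪q∣+∣p∩q∣≡∣p∣+∣q∣ (outside ∷ p) (outside ∷ q) = ∣p∪q∣+∣p∩q∣≡∣p∣+∣q∣ p q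

∣p∪q∣≤∣p∣+∣q∣ : ∀ (p q : Subset n) → ∣ p ∪ q ∣ ≤ ∣ p ∣ + ∣ q ∣
∣p∪q∣≤∣p∣+∣q∣ p q = ≤-trans (m≤m+n ∣ p ∪ q ∣ ∣ p ∩ q ∣) (≤-reflexive (∣p∪q∣+∣p∩q∣≡∣p∣+∣q∣ p q))

x∈p⇒0<∣p∣ : ∀ {p : Subset n} {x} → x ∈ p → 0 < ∣ p ∣
x∈p⇒0<∣p∣ x∈p = ≤-<-trans z≤n (x∈p⇒∣p-x∣<∣p∣ x∈p)

Empty⇒∣p∣≡0 : ∀ {p : Subset n} → Empty p → ∣ p ∣ ≡ 0
Empty⇒∣p∣≡0 {n} empty = trans (cong ∣_∣ (Empty-unique empty)) (∣⊥∣≡0 n)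

0<∣p∣⇒Nonempty : ∀ {p : Subset n} → 0 < ∣ p ∣ → Nonempty p
0<∣p∣⇒Nonempty {p = p} 0<∣p∣ with nonempty? p
... | yes ne    = ne
... | no  empty = ⊥-elim (<⇒≢ 0<∣p∣ (sym (Empty⇒∣p∣≡0 empty)))

x∈p∩q⇒∣p∪q∣<∣p∣+∣q∣ : ∀ (p q : Subset n) {x} → x ∈ p → x ∈ q → ∣ p ∪ q ∣ < ∣ p ∣ + ∣ q ∣
x∈p∩q⇒∣p∪q∣<∣p∣+∣q∣ p q x∈p x∈q = <-≤-trans
  (m<m+n ∣ p ∪ q ∣ (x∈p⇒0<∣p∣ (x∈p∩q⁺ (x∈p , x∈q))))
  (≤-reflexive (∣p∪q∣+∣p∩q∣≡∣p∣+∣q∣ p q))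

Empty[p∩q]⇒∣p∪q∣≡∣p∣+∣q∣ : ∀ (p q : Subset n) → Empty (p ∩ q) → ∣ p ∪ q ∣ ≡ ∣ p ∣ + ∣ q ∣
Empty[p∩q]⇒∣p∪q∣≡∣p∣+∣q∣ p q disjoint = begin
  ∣ p ∪ q ∣                 ≡⟨ +-identityʳ _ ⟨
  ∣ p ∪ q ∣ + 0             ≡⟨ cong (∣ p ∪ q ∣ +_) (Empty⇒∣p∣≡0 disjoint) ⟨
  ∣ p ∪ q ∣ + ∣ p ∩ q ∣     ≡⟨ ∣p∪q∣+∣p∩q∣≡∣p∣+∣q∣ p q ⟩
  ∣ p ∣ + ∣ q ∣             ∎
  where open ≡-Reasoning

suc∣p-x∣≡∣p∣ : ∀ {p : Subset n} {x} → x ∈ p → suc ∣ p ─ ⁅ x ⁆ ∣ ≡ ∣ p ∣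
suc∣p-x∣≡∣p∣ {p = inside ∷ p} here       = cong (suc ∘ ∣_∣) (p─⊥≡p p)
suc∣p-x∣≡∣p∣ {p = inside ∷ p} (there x∈) = cong suc (suc∣p-x∣≡∣p∣ x∈)
suc∣p-x∣≡∣p∣ {p = outside ∷ p} (there x∈) = suc∣p-x∣≡∣p∣ x∈

pick : ∀ {p : Subset n} {k} → suc k ≤ ∣ p ∣ → ∃[ x ] x ∈ p × k ≤ ∣ p ─ ⁅ x ⁆ ∣
pick k<∣p∣ with 0<∣p∣⇒Nonempty (≤-trans (s≤s z≤n) k<∣p∣)
... | x , x∈p = x , x∈p , s≤s⁻¹ (≤-trans k<∣p∣ (≤-reflexive (sym (suc∣p-x∣≡∣p∣ x∈p))))

pick-three : ∀ {p : Subset n} → 3 ≤ ∣ p ∣ →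
  ∃[ x ] ∃[ y ] ∃[ z ] x ∈ p × y ∈ p × z ∈ p × x ≢ y × x ≢ z × y ≢ z
pick-three {p = p} 3≤∣p∣ with pick 3≤∣p∣
... | x , x∈p , 2≤∣p-x∣ with pick 2≤∣p-x∣
... | y , y∈p-x , 1≤∣p-x-y∣ with pick 1≤∣p-x-y∣
... | z , z∈p-x-y , _ with x∈p-y⁻ p y∈p-x | x∈p-y⁻ (p ─ ⁅ x ⁆) z∈p-x-y
... | y∈p , y≢x | z∈p-x , z≢y with x∈p-y⁻ p z∈p-x
... | z∈p , z≢x = x , y , z , x∈p , y∈p , z∈p , y≢x ∘ sym , z≢x ∘ sym , z≢y ∘ sym

injectiveOn⇒∣p∣≤∣q∣ : ∀ (f : Fin a → Fin b) {p : Subset a} {q : Subset b} →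
  (∀ {x} → x ∈ p → f x ∈ q) → (∀ {x y} → x ∈ p → y ∈ p → f x ≡ f y → x ≡ y) → ∣ p ∣ ≤ ∣ q ∣
injectiveOn⇒∣p∣≤∣q∣ f {p} = go (⊂-wellFounded p)
  where
  go : ∀ {p q} → Acc _⊂_ p → (∀ {x} → x ∈ p → f x ∈ q) →
       (∀ {x y} → x ∈ p → y ∈ p → f x ≡ f y → x ≡ y) → ∣ p ∣ ≤ ∣ q ∣
  go {p} {q} (acc smaller) into inj with nonempty? p
  ... | no  empty    = ≤-trans (≤-reflexive (Empty⇒∣p∣≡0 empty)) z≤n
  ... | yes (x , x∈p) = begin
    ∣ p ∣                ≡⟨ suc∣p-x∣≡∣p∣ x∈p ⟨
    suc ∣ p ─ ⁅ x ⁆ ∣    ≤⟨ s≤s (go (smaller (x∈p⇒p-x⊂p x∈p)) into′ inj′) ⟩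
    suc ∣ q ─ ⁅ f x ⁆ ∣  ≡⟨ suc∣p-x∣≡∣p∣ (into x∈p) ⟩
    ∣ q ∣                ∎
    where
    open ≤-Reasoning
    inj′ : ∀ {y z} → y ∈ p ─ ⁅ x ⁆ → z ∈ p ─ ⁅ x ⁆ → f y ≡ f z → y ≡ z
    inj′ y∈ z∈ = inj (proj₁ (x∈p-y⁻ p y∈)) (proj₁ (x∈p-y⁻ p z∈))
    into′ : ∀ {y} → y ∈ p ─ ⁅ x ⁆ → f y ∈ q ─ ⁅ f x ⁆
    into′ y∈ with x∈p-y⁻ p y∈
    ... | y∈p , y≢x = x∈p∧x≢y⇒x∈p-y (into y∈p) (y≢x ∘ inj y∈p x∈p)

-- Expansions

incidentB-suc : (F : Fin (suc a) → Subset b) → incidentB F ≡ F zero ∪ incidentB (F ∘ suc)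
incidentB-suc F = cong (λ Fs → F zero ∪ ⋃ Fs)
  (trans (map-tabulate suc F) (sym (map-tabulate id (F ∘ suc))))

∈-incidentB : ∀ (F : Fin a → Subset b) x {i} → i ∈ F x → i ∈ incidentB F
∈-incidentB F zero    i∈ rewrite incidentB-suc F = x∈p∪q⁺ (inj₁ i∈)
∈-incidentB F (suc x) i∈ rewrite incidentB-suc F = x∈p∪q⁺ (inj₂ (∈-incidentB (F ∘ suc) x i∈))

∣incidentB∣≤sum : ∀ (F : Fin a → Subset b) → ∣ incidentB F ∣ ≤ sum (∣_∣ ∘ F)
∣incidentB∣≤sum {zero} {b} F = ≤-reflexive (∣⊥∣≡0 b)
∣incidentB∣≤sum {suc a} F rewrite incidentB-suc F = ≤-trans
  (∣p∪q∣≤∣p∣+∣q∣ (F zero) (incidentB (F ∘ suc))) (+-monoʳ-≤ ∣ F zero ∣ (∣incidentB∣≤sum (F ∘ suc)))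

∣incidentB∣<sum : ∀ (F : Fin a → Subset b) {x y i} → x ≢ y → i ∈ F x → i ∈ F y →
  ∣ incidentB F ∣ < sum (∣_∣ ∘ F)
∣incidentB∣<sum {suc a} F {zero} {zero} x≢y _ _ = ⊥-elim (x≢y refl)
∣incidentB∣<sum {suc a} F {zero} {suc y} _ i∈ i∈′ rewrite incidentB-suc F = <-≤-trans
  (x∈p∩q⇒∣p∪q∣<∣p∣+∣q∣ (F zero) _ i∈ (∈-incidentB (F ∘ suc) y i∈′))
  (+-monoʳ-≤ ∣ F zero ∣ (∣incidentB∣≤sum (F ∘ suc)))
∣incidentB∣<sum {suc a} F {suc x} {zero} _ i∈ i∈′ rewrite incidentB-suc F = <-≤-trans
  (x∈p∩q⇒∣p∪q∣<∣p∣+∣q∣ (F zero) _ i∈′ (∈-incidentB (F ∘ suc) x i∈))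
  (+-monoʳ-≤ ∣ F zero ∣ (∣incidentB∣≤sum (F ∘ suc)))
∣incidentB∣<sum {suc a} F {suc x} {suc y} x≢y i∈ i∈′ rewrite incidentB-suc F = ≤-<-trans
  (∣p∪q∣≤∣p∣+∣q∣ (F zero) (incidentB (F ∘ suc)))
  (+-monoʳ-< ∣ F zero ∣ (∣incidentB∣<sum (F ∘ suc) (x≢y ∘ cong suc) i∈ i∈′))

sum-constant-on : ∀ (p : Subset n) (f : Fin n → ℕ) {q} →
  (∀ {x} → x ∈ p → f x ≡ q) → (∀ {x} → x ∉ p → f x ≡ 0) → sum f ≡ q * ∣ p ∣
sum-constant-on []            f {q} on off = sym (*-zeroʳ q)
sum-constant-on (inside ∷ p)  f {q} on off = begin
  f zero + sum (f ∘ suc) ≡⟨ cong₂ _+_ (on here)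
                              (sum-constant-on p (f ∘ suc) (on ∘ there) (off ∘ (_∘ drop-there))) ⟩
  q + q * ∣ p ∣          ≡⟨ *-suc q ∣ p ∣ ⟨
  q * suc ∣ p ∣          ∎
  where open ≡-Reasoning
sum-constant-on (outside ∷ p) f on off =
  cong₂ _+_ (off (λ ())) (sum-constant-on p (f ∘ suc) (on ∘ there) (off ∘ (_∘ drop-there)))

expansion-disjoint : ∀ {Badj : Fin a → Fin b → Set} {q Â B̂ M} → IsExpansion Badj q Â B̂ M →
  ∀ {x y i} → i ∈ M x → i ∈ M y → x ≡ y
expansion-disjoint {a} {Â = Â} {M = M} (edges , degree , covered) {x} {y} i∈Mx i∈My
  with x Data.Fin.≟ y
... | yes x≡y = x≡y
... | no  x≢y = ⊥-elim (<-irrefl tight (∣incidentB∣<sum M x≢y i∈Mx i∈My))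
  where
  tight : ∣ incidentB M ∣ ≡ sum (∣_∣ ∘ M)
  tight = trans covered (sym (sum-constant-on Â (∣_∣ ∘ M) (degree _)
    (λ {z} z∉Â → Empty⇒∣p∣≡0 (λ (j , j∈) → z∉Â (proj₁ (edges z j j∈))))))

-- Intervals

Interval : Set
Interval = ℕ × ℕ

Meets : Interval → Interval → Set
Meets (a , b) (c , d) = a ≤ d × c ≤ b

_≺_ : Interval → Interval → Set
(_ , b) ≺ (c , _) = b < c

-- Shaped so that the non-nesting clause of ProperInterval reads ¬ (ι v ⊏ ι u).
_⊏_ : Interval → Interval → Set
(a , b) ⊏ (c , d) = c ≤ a × b ≤ d × (c < a ⊎ b < d)

¬Meets⇒≺⊎≻ : ∀ I J → ¬ Meets I J → I ≺ J ⊎ J ≺ I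
¬Meets⇒≺⊎≻ (a , b) (c , d) I∤J with a ≤? d
... | yes a≤d = inj₁ (≰⇒> (I∤J ∘ (a≤d ,_)))
... | no  a≰d = inj₂ (≰⇒> a≰d)

between⇒⊏ : ∀ {I J₁ J₂ J₃} → Meets I J₁ → J₁ ≺ J₂ → J₂ ≺ J₃ → Meets I J₃ → J₂ ⊏ I
between⇒⊏ (a≤b₁ , _) b₁<a₂ b₂<a₃ (_ , a₃≤b) =
  <⇒≤ a<a₂ , <⇒≤ (<-≤-trans b₂<a₃ a₃≤b) , inj₁ a<a₂
  where a<a₂ = ≤-<-trans a≤b₁ b₁<a₂

meets-three-disjoint⇒contains-one : ∀ {I J₁ J₂ J₃} → Meets I J₁ → Meets I J₂ → Meets I J₃ →
  ¬ Meets J₁ J₂ → ¬ Meets J₁ J₃ → ¬ Meets J₂ J₃ → J₁ ⊏ I ⊎ J₂ ⊏ I ⊎ J₃ ⊏ I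
meets-three-disjoint⇒contains-one {_} {J₁} {J₂} {J₃} m₁ m₂ m₃ d₁₂ d₁₃ d₂₃
  with ¬Meets⇒≺⊎≻ J₁ J₂ d₁₂ | ¬Meets⇒≺⊎≻ J₂ J₃ d₂₃ | ¬Meets⇒≺⊎≻ J₁ J₃ d₁₃
... | inj₁ 1≺2 | inj₁ 2≺3 | _       = inj₂ (inj₁ (between⇒⊏ m₁ 1≺2 2≺3 m₃))
... | inj₂ 2≺1 | inj₂ 3≺2 | _       = inj₂ (inj₁ (between⇒⊏ m₃ 3≺2 2≺1 m₁))
... | inj₁ 1≺2 | inj₂ 3≺2 | inj₁ 1≺3 = inj₂ (inj₂ (between⇒⊏ m₁ 1≺3 3≺2 m₂))
... | inj₁ 1≺2 | inj₂ 3≺2 | inj₂ 3≺1 = inj₁ (between⇒⊏ m₃ 3≺1 1≺2 m₂)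
... | inj₂ 2≺1 | inj₁ 2≺3 | inj₁ 1≺3 = inj₁ (between⇒⊏ m₂ 2≺1 1≺3 m₃)
... | inj₂ 2≺1 | inj₁ 2≺3 | inj₂ 3≺1 = inj₂ (inj₂ (between⇒⊏ m₂ 2≺3 3≺1 m₁))

-- Graphs

-- G ⊖ X, G [ C ] and their iterates are definitionally of the form G ↾ Z, so everything
-- proved about H ↾ Z applies to them.
_↾_ : MGraph n → Subset n → MGraph n
H ↾ Z = record { V = Z ; mult = mult H ; sym = MGraph.sym H ; loopless = loopless H }

module _ {H : MGraph n} where

  Adj-sym : Adj H u v → Adj H v u
  Adj-sym {u} {v} (u∈ , v∈ , uv) = v∈ , u∈ , subst (1 ≤_) (MGraph.sym H u v) uv

  Adj-irrefl : Adj H u v → u ≢ v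
  Adj-irrefl {u} (_ , _ , uu) refl = <-irrefl (sym (loopless H u)) uu

  Reach-endpoints : Reach H u v → u ∈ V H × v ∈ V H
  Reach-endpoints (here u∈)          = u∈ , u∈
  Reach-endpoints (there (u∈ , _) r) = u∈ , proj₂ (Reach-endpoints r)

  Reach-trans : Reach H u v → Reach H v w → Reach H u w
  Reach-trans (here _)    r′ = r′
  Reach-trans (there a r) r′ = there a (Reach-trans r r′)

  Reach-sym : Reach H u v → Reach H v u
  Reach-sym (here u∈)                 = here u∈
  Reach-sym (there a@(u∈ , _ , _) r) = Reach-trans (Reach-sym r) (there (Adj-sym a) (here u∈))

  Reach-preserves : (P : Fin n → Set) → (∀ {w w′} → P w → Adj H w w′ → P w′) →
    P u → Reach H u v → P v
  Reach-preserves P step Pu (here _)    = Pu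
  Reach-preserves P step Pu (there a r) = Reach-preserves P step (step Pu a) r

  Reach-restrict : ∀ {Z} → (∀ {w} → Reach H u w → w ∈ Z) → Reach H u v → Reach (H ↾ Z) u v
  Reach-restrict inZ (here u∈) = here (inZ (here u∈))
  Reach-restrict inZ (there a@(u∈ , w∈ , uw) r) =
    there (inZ (here u∈) , inZ (there a (here w∈)) , uw) (Reach-restrict (inZ ∘ there a) r)

record Claw (H : MGraph n) : Set where
  field
    centre leaf₁ leaf₂ leaf₃ : Fin n
    spoke₁ : Adj H centre leaf₁
    spoke₂ : Adj H centre leaf₂
    spoke₃ : Adj H centre leaf₃
    leaf₁≢leaf₂ : leaf₁ ≢ leaf₂
    leaf₁≢leaf₃ : leaf₁ ≢ leaf₃
    leaf₂≢leaf₃ : leaf₂ ≢ leaf₃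
    leaf₁≁leaf₂ : ¬ Adj H leaf₁ leaf₂
    leaf₁≁leaf₃ : ¬ Adj H leaf₁ leaf₃
    leaf₂≁leaf₃ : ¬ Adj H leaf₂ leaf₃

ProperInterval⇒¬Claw : ∀ {H : MGraph n} → ProperInterval H → ¬ Claw H
ProperInterval⇒¬Claw {H = H} (lo , hi , _ , adj⇔meets , unnested) claw =
  [ unnested′ spoke₁ , [ unnested′ spoke₂ , unnested′ spoke₃ ]′ ]′
    (meets-three-disjoint⇒contains-one (meets spoke₁) (meets spoke₂) (meets spoke₃)
      (apart leaf₁≢leaf₂ leaf₁≁leaf₂ spoke₁ spoke₂)
      (apart leaf₁≢leaf₃ leaf₁≁leaf₃ spoke₁ spoke₃)
      (apart leaf₂≢leaf₃ leaf₂≁leaf₃ spoke₂ spoke₃))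
  where
  open Claw claw
  ι : Fin _ → Interval
  ι v = lo v , hi v
  meets : ∀ {u v} → Adj H u v → Meets (ι u) (ι v)
  meets a@(u∈ , v∈ , _) = Equivalence.to (adj⇔meets _ _ u∈ v∈ (Adj-irrefl {H = H} a)) a
  apart : ∀ {u v} → u ≢ v → ¬ Adj H u v → Adj H centre u → Adj H centre v → ¬ Meets (ι u) (ι v)
  apart u≢v u≁v (_ , u∈ , _) (_ , v∈ , _) = u≁v ∘ Equivalence.from (adj⇔meets _ _ u∈ v∈ u≢v)
  unnested′ : ∀ {v} → Adj H centre v → ¬ (ι v ⊏ ι centre)
  unnested′ (c∈ , v∈ , _) = unnested _ _ c∈ v∈

module _ {H : MGraph n} {C : Subset n} (C-comp : IsComponent H C) where

  private
    root = proj₁ C-comp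
    root-reach : ∀ {v} → v ∈ C ⇔ Reach H root v
    root-reach = proj₂ (proj₂ C-comp) _

  component⊆V : C ⊆ V H
  component⊆V v∈C = proj₂ (Reach-endpoints (Equivalence.to root-reach v∈C))

  component-reach : x ∈ C → y ∈ C → Reach H x y
  component-reach x∈C y∈C =
    Reach-trans (Reach-sym (Equivalence.to root-reach x∈C)) (Equivalence.to root-reach y∈C)

  component-closed : x ∈ C → Reach H x y → y ∈ C
  component-closed x∈C r = Equivalence.from root-reach (Reach-trans (Equivalence.to root-reach x∈C) r)

  component-reach-inside : x ∈ C → y ∈ C → Reach (H [ C ]) x y
  component-reach-inside x∈C y∈C = Reach-restrict
    (λ r → x∈p∩q⁺ (component-closed x∈C r , proj₂ (Reach-endpoints r)))
    (component-reach x∈C y∈C)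

  component-connected : Connected (H [ C ])
  component-connected =
    (root , x∈p∩q⁺ (Equivalence.from root-reach (here (proj₁ (proj₂ C-comp))) , proj₁ (proj₂ C-comp))) ,
    λ x y x∈ y∈ → component-reach-inside (proj₁ (x∈p∩q⁻ _ _ x∈)) (proj₁ (x∈p∩q⁻ _ _ y∈))

component-unique : ∀ {H : MGraph n} {C D} → IsComponent H C → IsComponent H D →
  x ∈ C → x ∈ D → C ≡ D
component-unique C-comp D-comp x∈C x∈D = ⊆-antisym
  (λ y∈C → component-closed D-comp x∈D (component-reach C-comp x∈C y∈C))
  (λ y∈D → component-closed C-comp x∈C (component-reach D-comp x∈D y∈D))

module _ (f : Subset n → Subset n) (inflationary : ∀ {p} → p ⊆ f p) where

  ⊆-fold : ∀ p k → p ⊆ fold p f k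
  ⊆-fold p zero    = id
  ⊆-fold p (suc k) = inflationary ∘ ⊆-fold p k

  fixed-or-large : ∀ p k → f (fold p f k) ≡ fold p f k ⊎ k ≤ ∣ fold p f k ∣
  fixed-or-large p zero = inj₂ z≤n
  fixed-or-large p (suc k) with fixed-or-large p k
  ... | inj₁ fixed = inj₁ (cong f fixed)
  ... | inj₂ large with fold p f k ⊂? f (fold p f k)
  ...   | yes grows = inj₂ (<-≤-trans (s≤s large) (p⊂q⇒∣p∣<∣q∣ grows))
  ...   | no  ¬grows = inj₁ (cong f (⊆-antisym shrinks inflationary))
    where
    shrinks : f (fold p f k) ⊆ fold p f k
    shrinks {x} x∈ with x ∈? fold p f k
    ... | yes x∈′ = x∈′
    ... | no  x∉  = ⊥-elim (¬grows (inflationary , x , x∈ , x∉))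

  fold-fixpoint : ∀ p → f (fold p f (suc n)) ≡ fold p f (suc n)
  fold-fixpoint p with fixed-or-large p (suc n)
  ... | inj₁ fixed = fixed
  ... | inj₂ large = ⊥-elim (<-irrefl refl (<-≤-trans large (∣p∣≤n (fold p f (suc n)))))

module _ (H : MGraph n) where

  Adj? : ∀ u v → Dec (Adj H u v)
  Adj? u v = u ∈? V H ×-dec v ∈? V H ×-dec 1 ≤? mult H u v

  private
    grow : Subset n → Subset n
    grow R = select (λ v → v ∈? R ⊎-dec any? (λ w → w ∈? R ×-dec Adj? w v))

    grow-inflationary : ∀ {R} → R ⊆ grow R
    grow-inflationary x∈R = Equivalence.from (∈-select _) (inj₁ x∈R)

    grow-step : ∀ {R w v} → w ∈ R → Adj H w v → v ∈ grow R
    grow-step w∈R a = Equivalence.from (∈-select _) (inj₂ (_ , w∈R , a))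

  -- Closing ⁅ u ⁆ under adjacency stabilises within n + 1 rounds, as each round that
  -- changes the set adds a vertex.
  componentOf : Fin n → Subset n
  componentOf u = fold ⁅ u ⁆ grow (suc n)

  ∈-componentOf : u ∈ V H → v ∈ componentOf u ⇔ Reach H u v
  ∈-componentOf {u} u∈ = mk⇔ (sound (suc n)) complete
    where
    sound : ∀ k {v} → v ∈ fold ⁅ u ⁆ grow k → Reach H u v
    sound zero    v∈ rewrite x∈⁅y⁆⇒x≡y u v∈ = here u∈
    sound (suc k) v∈ with Equivalence.to (∈-select _) v∈
    ... | inj₁ v∈′          = sound k v∈′
    ... | inj₂ (w , w∈ , a) = Reach-trans (sound k w∈) (there a (here (proj₁ (proj₂ a))))
    complete : ∀ {v} → Reach H u v → v ∈ componentOf u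
    complete = Reach-preserves (_∈ componentOf u)
      (λ w∈ a → subst (_ ∈_) (fold-fixpoint grow grow-inflationary ⁅ u ⁆) (grow-step w∈ a))
      (⊆-fold grow grow-inflationary ⁅ u ⁆ (suc n) (x∈⁅x⁆ u))

  componentOf-isComponent : u ∈ V H → IsComponent H (componentOf u)
  componentOf-isComponent {u} u∈ = u , u∈ , λ v → ∈-componentOf u∈

-- Hereditary properties

GoodComponent : MGraph n → Subset n → Set
GoodComponent H C = ProperInterval (H [ C ]) ⊎ Tree (H [ C ])

module _ (H : MGraph n) {Z Z′ : Subset n} (Z⊆Z′ : Z ⊆ Z′) where

  Adj-mono : Adj (H ↾ Z) u v → Adj (H ↾ Z′) u v
  Adj-mono (u∈ , v∈ , uv) = Z⊆Z′ u∈ , Z⊆Z′ v∈ , uv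

  HasCycle-mono : HasCycle (H ↾ Z) → HasCycle (H ↾ Z′)
  HasCycle-mono (l , 3≤l , c , c-injective , c∈ , c-adj) =
    l , 3≤l , c , c-injective , Z⊆Z′ ∘ c∈ , λ i j next → Adj-mono (c-adj i j next)

  ProperInterval-antimono : ProperInterval (H ↾ Z′) → ProperInterval (H ↾ Z)
  ProperInterval-antimono (lo , hi , lo≤hi , adj⇔meets , unnested) =
    lo , hi , (λ v → lo≤hi v ∘ Z⊆Z′) ,
    (λ u v u∈ v∈ u≢v → mk⇔
      (Equivalence.to (adj⇔meets u v (Z⊆Z′ u∈) (Z⊆Z′ v∈) u≢v) ∘ Adj-mono)
      (λ m → u∈ , v∈ , proj₂ (proj₂ (Equivalence.from (adj⇔meets u v (Z⊆Z′ u∈) (Z⊆Z′ v∈) u≢v) m)))) ,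
    λ u v u∈ v∈ → unnested u v (Z⊆Z′ u∈) (Z⊆Z′ v∈)

GoodComponent-inherit : ∀ (H : MGraph n) {Z C} → (∀ D → IsComponent H D → GoodComponent H D) →
  IsComponent (H ↾ Z) C → C ⊆ V H → GoodComponent (H ↾ Z) C
GoodComponent-inherit H {Z} {C} H-good C-comp@(r , r∈Z , r-reach) C⊆V =
  inherit (H-good (componentOf H r) (componentOf-isComponent H r∈V))
  where
  r∈V : r ∈ V H
  r∈V = C⊆V (Equivalence.from (r-reach r) (here r∈Z))
  C∩Z⊆D∩V : C ∩ Z ⊆ componentOf H r ∩ V H
  C∩Z⊆D∩V v∈ = x∈p∩q⁺ (Equivalence.from (∈-componentOf H r∈V) (Reach-restrict
      (C⊆V ∘ Equivalence.from (r-reach _)) (Equivalence.to (r-reach _) v∈C)) , C⊆V v∈C)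
    where v∈C = proj₁ (x∈p∩q⁻ _ _ v∈)
  inherit : GoodComponent H (componentOf H r) → GoodComponent (H ↾ Z) C
  inherit (inj₁ interval)      = inj₁ (ProperInterval-antimono H C∩Z⊆D∩V interval)
  inherit (inj₂ (_ , acyclic)) = inj₂ (component-connected C-comp , acyclic ∘ HasCycle-mono H C∩Z⊆D∩V)

-- The reduction

i+j≤k⇔i≤k-j : ∀ i j k → i ℤ.+ j ℤ.≤ k ⇔ i ℤ.≤ k ℤ.- j
i+j≤k⇔i≤k-j i j k = mk⇔
  (λ i+j≤k → subst (ℤ._≤ k ℤ.- j) (i+j-j≡i i j) (ℤ.+-monoˡ-≤ (ℤ.- j) i+j≤k))
  (λ i≤k-j → subst (i ℤ.+ j ℤ.≤_) (k-j+j≡k k j) (ℤ.+-monoˡ-≤ j i≤k-j))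
  where
  i+j-j≡i : ∀ i j → i ℤ.+ j ℤ.- j ≡ i
  i+j-j≡i = solve-∀
  k-j+j≡k : ∀ k j → k ℤ.- j ℤ.+ j ≡ k
  k-j+j≡k = solve-∀

PITVD-⊖⇒PITVD : ∀ {G : MGraph n} {T : Subset n} {k} →
  T ⊆ V G → PITVD (G ⊖ T) (k ℤ.- ℤ.+ ∣ T ∣) → PITVD G k
PITVD-⊖⇒PITVD {G = G} {T} {k} T⊆V (Y , Y⊆V-T , Y-budget , Y-good) =
  Y ∪ T , Y∪T⊆V , budget , subst (λ Z → Good (G ↾ Z)) V-T-Y≡V-[Y∪T] Y-good
  where
  Y∪T⊆V : Y ∪ T ⊆ V G
  Y∪T⊆V x∈ = [ p─q⊆p (V G) T ∘ Y⊆V-T , T⊆V ]′ (x∈p∪q⁻ Y T x∈)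
  Y∩T-empty : Empty (Y ∩ T)
  Y∩T-empty (x , x∈) = x∈p─q⇒x∉q (V G) T (Y⊆V-T (proj₁ (x∈p∩q⁻ Y T x∈))) (proj₂ (x∈p∩q⁻ Y T x∈))
  budget : ℤ.+ ∣ Y ∪ T ∣ ℤ.≤ k
  budget rewrite Empty[p∩q]⇒∣p∪q∣≡∣p∣+∣q∣ Y T Y∩T-empty | ℤ.pos-+ ∣ Y ∣ ∣ T ∣ =
    Equivalence.from (i+j≤k⇔i≤k-j (ℤ.+ ∣ Y ∣) (ℤ.+ ∣ T ∣) k) Y-budget
  V-T-Y≡V-[Y∪T] : V G ─ T ─ Y ≡ V G ─ (Y ∪ T)
  V-T-Y≡V-[Y∪T] = trans (p─q─r≡p─q∪r (V G) T Y) (cong (V G ─_) (∪-comm T Y))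

module Reduction
  (G : MGraph n) (S : Subset n) (S⊆V : S ⊆ V G) (S-good : Good (G ⊖ S))
  (V₁ : Subset n)
  (V₁-spec : ∀ v → (v ∈ V₁) ⇔ Σ (Subset n) (λ C → IsComponent (G ⊖ S) C × v ∈ C × HasCycle ((G ⊖ S) [ C ])))
  {m : ℕ} (comp : Fin m → Subset n) (comp-injective : Injective _≡_ _≡_ comp)
  (comp-component : ∀ i → IsComponent (G [ V₁ ]) (comp i))
  (Ŝ : Subset n) (Ĉ : Subset m) (Ŝ⊆S : Ŝ ⊆ S) (M : Fin n → Subset m)
  (M-expansion : IsExpansion (λ s i → s ∈ S × Σ (Fin n) (λ v → v ∈ comp i × Adj G s v)) 3 Ŝ Ĉ M)
  (Ĉ-closed : ∀ s i → i ∈ Ĉ → s ∈ S → Σ (Fin n) (λ v → v ∈ comp i × Adj G s v) → s ∈ Ŝ)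
  where

  private variable
    i j : Fin m
    s : Fin n

  V₁⊆V-S : V₁ ⊆ V G ─ S
  V₁⊆V-S v∈V₁ with Equivalence.to (V₁-spec _) v∈V₁
  ... | C , C-comp , v∈C , _ = component⊆V C-comp v∈C

  comp⊆V₁ : comp i ⊆ V₁
  comp⊆V₁ = proj₁ ∘ x∈p∩q⁻ _ _ ∘ component⊆V (comp-component _)

  comp⊆V-S : comp i ⊆ V G ─ S
  comp⊆V-S = V₁⊆V-S ∘ comp⊆V₁

  comp-disjoint : v ∈ comp i → v ∈ comp j → i ≡ j
  comp-disjoint v∈i v∈j = comp-injective (component-unique (comp-component _) (comp-component _) v∈i v∈j)

  comp-closed : v ∈ comp i → w ∈ V G ─ S → 1 ≤ mult G v w → w ∈ comp i
  comp-closed {v} {i} {w} v∈i w∈ vw with Equivalence.to (V₁-spec v) (comp⊆V₁ v∈i)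
  ... | C , C-comp , v∈C , cycle =
    component-closed (comp-component i) v∈i (there edge (here (proj₁ (proj₂ edge))))
    where
    w∈V₁ : w ∈ V₁
    w∈V₁ = Equivalence.from (V₁-spec w)
      (C , C-comp , component-closed C-comp v∈C (there (comp⊆V-S v∈i , w∈ , vw) (here w∈)) , cycle)
    edge : Adj (G [ V₁ ]) v w
    edge = x∈p∩q⁺ (comp⊆V₁ v∈i , p─q⊆p _ S (comp⊆V-S v∈i)) , x∈p∩q⁺ (w∈V₁ , p─q⊆p _ S w∈) , vw

  comp-closed-off-Ŝ : i ∈ Ĉ → v ∈ comp i → w ∈ V G ─ Ŝ → 1 ≤ mult G v w → w ∈ comp i
  comp-closed-off-Ŝ {i} {v} {w} i∈Ĉ v∈i w∈ vw with w ∈? S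
  ... | no  w∉S = comp-closed v∈i (x∈p∧x∉q⇒x∈p─q (p─q⊆p _ Ŝ w∈) w∉S) vw
  ... | yes w∈S = ⊥-elim (x∈p─q⇒x∉q (V G) Ŝ w∈ (Ĉ-closed w i i∈Ĉ w∈S (v , v∈i , Adj-sym {H = G} edge)))
    where
    edge : Adj G v w
    edge = p─q⊆p _ S (comp⊆V-S v∈i) , p─q⊆p _ Ŝ w∈ , vw

  comp-has-cycle : v ∈ comp i → HasCycle (G ↾ comp i)
  comp-has-cycle {v} {i} v∈i with Equivalence.to (V₁-spec v) (comp⊆V₁ v∈i)
  ... | C , C-comp , v∈C , cycle = HasCycle-mono G C∖S⊆comp cycle
    where
    C∖S⊆comp : C ∩ (V G ─ S) ⊆ comp i
    C∖S⊆comp w∈ = Reach-preserves (_∈ comp i) (λ { u∈ (_ , u′∈ , uu′) → comp-closed u∈ u′∈ uu′ }) v∈i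
      (component-reach C-comp v∈C (proj₁ (x∈p∩q⁻ _ _ w∈)))

  ⋃Ĉ : Subset n
  ⋃Ĉ = select (λ v → any? (λ i → i ∈? Ĉ ×-dec v ∈? comp i))

  ∈⋃Ĉ : i ∈ Ĉ → v ∈ comp i → v ∈ ⋃Ĉ
  ∈⋃Ĉ i∈Ĉ v∈i = Equivalence.from (∈-select _) (_ , i∈Ĉ , v∈i)

  ∈⋃Ĉ⁻ : v ∈ ⋃Ĉ → ∃[ i ] i ∈ Ĉ × v ∈ comp i
  ∈⋃Ĉ⁻ = Equivalence.to (∈-select _)

  ⋃Ĉ⊆V-S : ⋃Ĉ ⊆ V G ─ S
  ⋃Ĉ⊆V-S = comp⊆V-S ∘ proj₂ ∘ proj₂ ∘ ∈⋃Ĉ⁻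

  M⊆Ĉ : i ∈ M s → i ∈ Ĉ
  M⊆Ĉ i∈M = proj₁ (proj₂ (proj₁ M-expansion _ _ i∈M))

  M-neighbour : i ∈ M s → ∃[ v ] v ∈ comp i × Adj G s v
  M-neighbour i∈M = proj₂ (proj₂ (proj₂ (proj₁ M-expansion _ _ i∈M)))

  ∣M∣≡3 : s ∈ Ŝ → ∣ M s ∣ ≡ 3
  ∣M∣≡3 = proj₁ (proj₂ M-expansion) _

  Hits : Subset n → Fin n → Set
  Hits X s = ∃[ v ] v ∈ X × ∃[ i ] i ∈ M s × v ∈ comp i

  hits? : ∀ X s → Dec (Hits X s)
  hits? X s = any? (λ v → v ∈? X ×-dec any? (λ i → i ∈? M s ×-dec v ∈? comp i))

  -- If X misses the components M s, they lie in the component K of s in G − X; then K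
  -- contains a cycle, and s with one neighbour in each of them is a claw.
  module _ {X : Subset n} {s : Fin n} (s∈Ŝ : s ∈ Ŝ) (s∉X : s ∉ X) (misses : ¬ Hits X s) where

    private
      K : Subset n
      K = componentOf (G ⊖ X) s

    s∈V-X : s ∈ V G ─ X
    s∈V-X = x∈p∧x∉q⇒x∈p─q (S⊆V (Ŝ⊆S s∈Ŝ)) s∉X

    s∈K : s ∈ K ∩ (V G ─ X)
    s∈K = x∈p∩q⁺ (Equivalence.from (∈-componentOf (G ⊖ X) s∈V-X) (here s∈V-X) , s∈V-X)

    comp⊆V-X : i ∈ M s → comp i ⊆ V G ─ X
    comp⊆V-X i∈M v∈i = x∈p∧x∉q⇒x∈p─q (p─q⊆p _ S (comp⊆V-S v∈i)) (λ v∈X → misses (_ , v∈X , _ , i∈M , v∈i))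

    comp⊆K : i ∈ M s → comp i ⊆ K ∩ (V G ─ X)
    comp⊆K {i} i∈M {v} v∈i with M-neighbour i∈M
    ... | v₀ , v₀∈i , (_ , _ , sv₀) =
      x∈p∩q⁺ (Equivalence.from (∈-componentOf (G ⊖ X) s∈V-X) s⇝v , comp⊆V-X i∈M v∈i)
      where
      s⇝v : Reach (G ⊖ X) s v
      s⇝v = there (s∈V-X , comp⊆V-X i∈M v₀∈i , sv₀) (Reach-restrict
        (comp⊆V-X i∈M ∘ proj₁ ∘ x∈p∩q⁻ _ _ ∘ proj₂ ∘ Reach-endpoints)
        (component-reach-inside (comp-component i) v₀∈i v∈i))

    leaf : i ∈ M s → Fin n
    leaf = proj₁ ∘ M-neighbour

    leaf∈comp : (i∈M : i ∈ M s) → leaf i∈M ∈ comp i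
    leaf∈comp = proj₁ ∘ proj₂ ∘ M-neighbour

    spoke : (i∈M : i ∈ M s) → Adj ((G ⊖ X) [ K ]) s (leaf i∈M)
    spoke i∈M = s∈K , comp⊆K i∈M (leaf∈comp i∈M) , proj₂ (proj₂ (proj₂ (proj₂ (M-neighbour i∈M))))

    leaves-distinct : (i∈M : i ∈ M s) (j∈M : j ∈ M s) → i ≢ j → leaf i∈M ≢ leaf j∈M
    leaves-distinct i∈M j∈M i≢j same =
      i≢j (comp-disjoint (leaf∈comp i∈M) (subst (_∈ comp _) (sym same) (leaf∈comp j∈M)))

    leaves-apart : (i∈M : i ∈ M s) (j∈M : j ∈ M s) → i ≢ j → ¬ Adj ((G ⊖ X) [ K ]) (leaf i∈M) (leaf j∈M)
    leaves-apart i∈M j∈M i≢j (_ , _ , uv) =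
      i≢j (comp-disjoint (comp-closed (leaf∈comp i∈M) (comp⊆V-S (leaf∈comp j∈M)) uv) (leaf∈comp j∈M))

    ¬Hits⇒¬GoodComponent : ¬ GoodComponent (G ⊖ X) K
    ¬Hits⇒¬GoodComponent good with pick-three (≤-reflexive (sym (∣M∣≡3 s∈Ŝ))) | good
    ... | i₁ , i₂ , i₃ , i₁∈ , i₂∈ , i₃∈ , i₁≢i₂ , i₁≢i₃ , i₂≢i₃ | inj₁ interval =
      ProperInterval⇒¬Claw {H = (G ⊖ X) [ K ]} interval record
        { centre = s ; leaf₁ = leaf i₁∈ ; leaf₂ = leaf i₂∈ ; leaf₃ = leaf i₃∈
        ; spoke₁ = spoke i₁∈ ; spoke₂ = spoke i₂∈ ; spoke₃ = spoke i₃∈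
        ; leaf₁≢leaf₂ = leaves-distinct i₁∈ i₂∈ i₁≢i₂
        ; leaf₁≢leaf₃ = leaves-distinct i₁∈ i₃∈ i₁≢i₃
        ; leaf₂≢leaf₃ = leaves-distinct i₂∈ i₃∈ i₂≢i₃
        ; leaf₁≁leaf₂ = leaves-apart i₁∈ i₂∈ i₁≢i₂
        ; leaf₁≁leaf₃ = leaves-apart i₁∈ i₃∈ i₁≢i₃
        ; leaf₂≁leaf₃ = leaves-apart i₂∈ i₃∈ i₂≢i₃
        }
    ... | _ , _ , _ , i₁∈ , _ | inj₂ (_ , acyclic) =
      acyclic (HasCycle-mono G (comp⊆K i₁∈) (comp-has-cycle (leaf∈comp i₁∈)))

  solution-hits : ∀ {X} → Good (G ⊖ X) → s ∈ Ŝ → s ∉ X → Hits X s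
  solution-hits {s} {X} (_ , X-good) s∈Ŝ s∉X with hits? X s
  ... | yes hit    = hit
  ... | no  misses = ⊥-elim (¬Hits⇒¬GoodComponent s∈Ŝ s∉X misses
    (X-good _ (componentOf-isComponent (G ⊖ X) (s∈V-X s∈Ŝ s∉X misses))))

  module Shrink {X : Subset n} (X⊆V : X ⊆ V G) (X-good : Good (G ⊖ X)) where

    Y : Subset n
    Y = X ─ (Ŝ ∪ ⋃Ĉ)

    Y∪Ŝ-avoids-⋃Ĉ : x ∈ Y ∪ Ŝ → x ∉ ⋃Ĉ
    Y∪Ŝ-avoids-⋃Ĉ {x} x∈ x∈⋃Ĉ with x∈p∪q⁻ Y Ŝ x∈
    ... | inj₁ x∈Y = x∈p─q⇒x∉q X (Ŝ ∪ ⋃Ĉ) x∈Y (x∈p∪q⁺ (inj₂ x∈⋃Ĉ))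
    ... | inj₂ x∈Ŝ = x∈p─q⇒x∉q (V G) S (⋃Ĉ⊆V-S x∈⋃Ĉ) (Ŝ⊆S x∈Ŝ)

    -- Vertices of X stay put and s ∈ Ŝ ∖ X moves to a vertex of X in a component of M s.
    -- Moved images lie in ⋃Ĉ, which Y ∪ Ŝ avoids, and the sets M s are pairwise disjoint.
    data Image (x : Fin n) : Fin n → Set where
      kept  : x ∈ X → Image x x
      moved : v ∈ X → i ∈ M x → v ∈ comp i → Image x v

    image : Fin n → Fin n
    image x with x ∈? X | x ∈? Ŝ
    ... | yes _   | _       = x
    ... | no  x∉X | yes x∈Ŝ = proj₁ (solution-hits X-good x∈Ŝ x∉X)
    ... | no  _   | no  _   = x

    image-spec : x ∈ Y ∪ Ŝ → Image x (image x)
    image-spec {x} x∈ with x ∈? X | x ∈? Ŝ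
    ... | yes x∈X | _       = kept x∈X
    ... | no  x∉X | yes x∈Ŝ =
      let v , v∈X , _ , i∈M , v∈i = solution-hits X-good x∈Ŝ x∉X in moved v∈X i∈M v∈i
    ... | no  x∉X | no  x∉Ŝ = ⊥-elim ([ x∉X ∘ p─q⊆p X _ , x∉Ŝ ]′ (x∈p∪q⁻ Y Ŝ x∈))

    Image⇒∈X : Image x v → v ∈ X
    Image⇒∈X (kept v∈X)      = v∈X
    Image⇒∈X (moved v∈X _ _) = v∈X

    Image-injective : x ∈ Y ∪ Ŝ → y ∈ Y ∪ Ŝ → Image x v → Image y v → x ≡ y
    Image-injective _   _   (kept _)          (kept _)          = refl
    Image-injective x∈  _   (kept _)          (moved _ j∈M v∈j) = ⊥-elim (Y∪Ŝ-avoids-⋃Ĉ x∈ (∈⋃Ĉ (M⊆Ĉ j∈M) v∈j))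
    Image-injective _   y∈  (moved _ i∈M v∈i) (kept _)          = ⊥-elim (Y∪Ŝ-avoids-⋃Ĉ y∈ (∈⋃Ĉ (M⊆Ĉ i∈M) v∈i))
    Image-injective _   _   (moved _ i∈M v∈i) (moved _ j∈M v∈j) with comp-disjoint v∈i v∈j
    ... | refl = expansion-disjoint M-expansion i∈M j∈M

    ∣Y∣+∣Ŝ∣≤∣X∣ : ∣ Y ∣ + ∣ Ŝ ∣ ≤ ∣ X ∣
    ∣Y∣+∣Ŝ∣≤∣X∣ = begin
      ∣ Y ∣ + ∣ Ŝ ∣ ≡⟨ Empty[p∩q]⇒∣p∪q∣≡∣p∣+∣q∣ Y Ŝ Y∩Ŝ-empty ⟨
      ∣ Y ∪ Ŝ ∣     ≤⟨ injectiveOn⇒∣p∣≤∣q∣ image (Image⇒∈X ∘ image-spec) injective ⟩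
      ∣ X ∣         ∎
      where
      open ≤-Reasoning
      Y∩Ŝ-empty : Empty (Y ∩ Ŝ)
      Y∩Ŝ-empty (x , x∈) =
        x∈p─q⇒x∉q X (Ŝ ∪ ⋃Ĉ) (proj₁ (x∈p∩q⁻ Y Ŝ x∈)) (x∈p∪q⁺ (inj₁ (proj₂ (x∈p∩q⁻ Y Ŝ x∈))))
      injective : ∀ {x y} → x ∈ Y ∪ Ŝ → y ∈ Y ∪ Ŝ → image x ≡ image y → x ≡ y
      injective {y = y} x∈ y∈ same =
        Image-injective x∈ y∈ (image-spec x∈) (subst (Image y) (sym same) (image-spec y∈))

    Y⊆V-Ŝ : Y ⊆ V G ─ Ŝ
    Y⊆V-Ŝ y∈Y = x∈p∧x∉q⇒x∈p─q (X⊆V (p─q⊆p X _ y∈Y)) (x∈p─q⇒x∉q X (Ŝ ∪ ⋃Ĉ) y∈Y ∘ x∈p∪q⁺ ∘ inj₁)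

    ⋃Ĉ-closed : u ∈ ⋃Ĉ → Adj ((G ⊖ Ŝ) ⊖ Y) u v → v ∈ ⋃Ĉ
    ⋃Ĉ-closed u∈⋃Ĉ (_ , v∈ , uv) with ∈⋃Ĉ⁻ u∈⋃Ĉ
    ... | i , i∈Ĉ , u∈i = ∈⋃Ĉ i∈Ĉ (comp-closed-off-Ŝ i∈Ĉ u∈i (p─q⊆p _ Y v∈) uv)

    ∉⋃Ĉ-closed : u ∉ ⋃Ĉ → Adj ((G ⊖ Ŝ) ⊖ Y) u v → v ∉ ⋃Ĉ
    ∉⋃Ĉ-closed u∉⋃Ĉ a v∈⋃Ĉ = u∉⋃Ĉ (⋃Ĉ-closed v∈⋃Ĉ (Adj-sym {H = (G ⊖ Ŝ) ⊖ Y} a))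

    outside-⋃Ĉ⊆V-X : v ∈ V G ─ Ŝ ─ Y → v ∉ ⋃Ĉ → v ∈ V G ─ X
    outside-⋃Ĉ⊆V-X v∈ v∉⋃Ĉ = x∈p∧x∉q⇒x∈p─q (p─q⊆p _ Ŝ (p─q⊆p _ Y v∈)) λ v∈X →
      x∈p─q⇒x∉q _ Y v∈ (x∈p∧x∉q⇒x∈p─q v∈X
        ([ x∈p─q⇒x∉q (V G) Ŝ (p─q⊆p _ Y v∈) , v∉⋃Ĉ ]′ ∘ x∈p∪q⁻ Ŝ ⋃Ĉ))

    shrunk-simple : Simple ((G ⊖ Ŝ) ⊖ Y)
    shrunk-simple u v u∈ v∈ with 1 ≤? mult G u v | u ∈? ⋃Ĉ
    ... | no  ¬uv | _        = <⇒≤ (≰⇒> ¬uv)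
    ... | yes uv  | yes u∈⋃Ĉ = proj₁ S-good u v (⋃Ĉ⊆V-S u∈⋃Ĉ) (⋃Ĉ⊆V-S (⋃Ĉ-closed u∈⋃Ĉ (u∈ , v∈ , uv)))
    ... | yes uv  | no  u∉⋃Ĉ = proj₁ X-good u v (outside-⋃Ĉ⊆V-X u∈ u∉⋃Ĉ)
      (outside-⋃Ĉ⊆V-X v∈ (∉⋃Ĉ-closed u∉⋃Ĉ (u∈ , v∈ , uv)))

    shrunk-good : Good ((G ⊖ Ŝ) ⊖ Y)
    shrunk-good = shrunk-simple , good-component
      where
      good-component : ∀ C → IsComponent ((G ⊖ Ŝ) ⊖ Y) C → GoodComponent ((G ⊖ Ŝ) ⊖ Y) C
      good-component C C-comp@(r , r∈ , r-reach) with r ∈? ⋃Ĉ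
      ... | yes r∈⋃Ĉ = GoodComponent-inherit (G ⊖ S) (proj₂ S-good) C-comp
        (⋃Ĉ⊆V-S ∘ Reach-preserves (_∈ ⋃Ĉ) ⋃Ĉ-closed r∈⋃Ĉ ∘ Equivalence.to (r-reach _))
      ... | no  r∉⋃Ĉ = GoodComponent-inherit (G ⊖ X) (proj₂ X-good) C-comp λ v∈C →
        let r⇝v = Equivalence.to (r-reach _) v∈C in
        outside-⋃Ĉ⊆V-X (proj₂ (Reach-endpoints r⇝v))
          (Reach-preserves (_∉ ⋃Ĉ) ∉⋃Ĉ-closed r∉⋃Ĉ r⇝v)

  PITVD⇒PITVD-⊖Ŝ : ∀ {k} → PITVD G k → PITVD (G ⊖ Ŝ) (k ℤ.- ℤ.+ ∣ Ŝ ∣)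
  PITVD⇒PITVD-⊖Ŝ {k} (X , X⊆V , X-budget , X-good) = Y , Y⊆V-Ŝ , budget , shrunk-good
    where
    open Shrink X⊆V X-good
    budget : ℤ.+ ∣ Y ∣ ℤ.≤ k ℤ.- ℤ.+ ∣ Ŝ ∣
    budget = Equivalence.to (i+j≤k⇔i≤k-j (ℤ.+ ∣ Y ∣) (ℤ.+ ∣ Ŝ ∣) k)
      (subst (ℤ._≤ k) (ℤ.pos-+ ∣ Y ∣ ∣ Ŝ ∣) (ℤ.≤-trans (ℤ.+≤+ ∣Y∣+∣Ŝ∣≤∣X∣) X-budget))

-- Opened only here: unqualified, +_ would make ℕ-sums above ambiguous.
open import Data.Integer using (ℤ; +_; _-_)

lemma17 : ∀ {n} (G : MGraph n) (k : ℤ) (S : Subset n) →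
  S ⊆ V G →
  Good (G ⊖ S) →
  (V₁ : Subset n) →
  (∀ v → (v ∈ V₁) ⇔ Σ (Subset n) (λ C → IsComponent (G ⊖ S) C × v ∈ C × HasCycle ((G ⊖ S) [ C ]))) →
  (m : ℕ) (comp : Fin m → Subset n) →
  Injective _≡_ _≡_ comp →
  (∀ i → IsComponent (G [ V₁ ]) (comp i)) →
  (∀ C → IsComponent (G [ V₁ ]) C → Σ (Fin m) (λ i → comp i ≡ C)) →
  3 * ∣ S ∣ ≤ m →
  (Ŝ : Subset n) (Ĉ : Subset m) →
  Ŝ ⊆ S → Nonempty Ŝ → Nonempty Ĉ →
  Σ (Fin n → Subset m) (λ M → IsExpansion (λ s i → s ∈ S × Σ (Fin n) (λ v → v ∈ comp i × Adj G s v)) 3 Ŝ Ĉ M) →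
  (∀ s i → i ∈ Ĉ → s ∈ S → Σ (Fin n) (λ v → v ∈ comp i × Adj G s v) → s ∈ Ŝ) →
  PITVD G k ⇔ PITVD (G ⊖ Ŝ) (k - + ∣ Ŝ ∣)
-- The completeness of comp, 3 * ∣ S ∣ ≤ m and the non-emptiness of Ŝ and Ĉ serve in the
-- paper only to produce Ŝ, Ĉ and the expansion; the equivalence itself does not use them.
lemma17 G k S S⊆V S-good V₁ V₁-spec m comp comp-injective comp-component _ _
        Ŝ Ĉ Ŝ⊆S _ _ (M , M-expansion) Ĉ-closed =
  mk⇔ PITVD⇒PITVD-⊖Ŝ (PITVD-⊖⇒PITVD (S⊆V ∘ Ŝ⊆S))
  where
  open Reduction G S S⊆V S-good V₁ V₁-spec comp comp-injective comp-component Ŝ Ĉ Ŝ⊆S M M-expansion Ĉ-closed
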